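{- The logic $\mathsf{B}^e$ is not passively structurally complete, while the logic $\mathsf{NB}^e$ is structurally complete.
   Context: Formulas are built from variables with connectives $\vee,\wedge$ (binary), $\neg,J_0,J_1,J_2$ (unary) and constants $0,1$. Let $\mathbf{WK}^e$ be the three-element algebra on $\{0,\tfrac12,1\}$ with $\neg 1=0,\neg\tfrac12=\tfrac12,\neg0=1$; $\vee,\wedge$ equal to $\tfrac12$ when one argument is $\tfrac12$ and Boolean otherwise; $J_0:0\mapsto1,\tfrac12\mapsto0,1\mapsto0$; $J_1:\tfrac12\mapsto1$, $0,1\mapsto 0$; $J_2:1\mapsto1$, $0,\tfrac12\mapsto0$. Bochvar external logic $\mathsf{B}^e$: $\Gamma\vdash\varphi$ iff every homomorphism from the formula algebra to $\mathbf{WK}^e$ sending all of $\Gamma$ to $1$ sends $\varphi$ to $1$. $\mathsf{NB}^e$ is the extension of $\mathsf{B}^e$ by the rule $J_1\varphi\vdash\psi$. A rule $\langle\Gamma,\psi\rangle$ is admissible in a logic $\vdash$ if adding it to $\vdash$ yields no new theorems; it is derivable if $\Gamma\vdash\psi$. A rule is passive if it has the form $\langle\Gamma,y\rangle$ with $y$ a variable not occurring in $\Gamma$. A logic is structurally complete if every admissible rule is derivable, and passively structurally complete if every passive admissible rule is derivable. -}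

module Defs where

open import Level using (Lift) renaming (zero to lzero; suc to lsuc)
open import Data.Nat using (ℕ)
open import Data.List using (List; []; _∷_)
open import Data.List.Membership.Propositional using (_∈_)
open import Data.List.Relation.Unary.All using (All)
open import Data.List.Relation.Unary.Any using (Any)
open import Data.Empty using (⊥)
open import Data.Product using (Σ; _×_; _,_; proj₁; proj₂)
open import Relation.Binary.PropositionalEquality using (_≡_)
open import Relation.Nullary using (¬_)

data Fm : Set where
  var  : ℕ → Fm
  _∨ᶠ_ : Fm → Fm → Fm
  _∧ᶠ_ : Fm → Fm → Fm
  ¬ᶠ_  : Fm → Fm
  J₀ᶠ  : Fm → Fm
  J₁ᶠ  : Fm → Fm
  J₂ᶠ  : Fm → Fm
  0ᶠ   : Fm
  1ᶠ   : Fm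

-- Substitutions are endomorphisms of the formula algebra, determined by
-- their values on variables.
Subst : Set
Subst = ℕ → Fm

sub : Subst → Fm → Fm
sub σ (var x)  = σ x
sub σ (φ ∨ᶠ ψ) = sub σ φ ∨ᶠ sub σ ψ
sub σ (φ ∧ᶠ ψ) = sub σ φ ∧ᶠ sub σ ψ
sub σ (¬ᶠ φ)   = ¬ᶠ sub σ φ
sub σ (J₀ᶠ φ)  = J₀ᶠ (sub σ φ)
sub σ (J₁ᶠ φ)  = J₁ᶠ (sub σ φ)
sub σ (J₂ᶠ φ)  = J₂ᶠ (sub σ φ)
sub σ 0ᶠ       = 0ᶠ
sub σ 1ᶠ       = 1ᶠ

data Occurs (y : ℕ) : Fm → Set where
  here : Occurs y (var y)
  ∨l : ∀ {φ ψ} → Occurs y φ → Occurs y (φ ∨ᶠ ψ)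
  ∨r : ∀ {φ ψ} → Occurs y ψ → Occurs y (φ ∨ᶠ ψ)
  ∧l : ∀ {φ ψ} → Occurs y φ → Occurs y (φ ∧ᶠ ψ)
  ∧r : ∀ {φ ψ} → Occurs y ψ → Occurs y (φ ∧ᶠ ψ)
  ¬o : ∀ {φ} → Occurs y φ → Occurs y (¬ᶠ φ)
  J₀o : ∀ {φ} → Occurs y φ → Occurs y (J₀ᶠ φ)
  J₁o : ∀ {φ} → Occurs y φ → Occurs y (J₁ᶠ φ)
  J₂o : ∀ {φ} → Occurs y φ → Occurs y (J₂ᶠ φ)

-- The algebra WKᵉ on {0, ½, 1}

data V3 : Set where
  v0 vh v1 : V3

_∨ʷ_ : V3 → V3 → V3
vh ∨ʷ _  = vh
_  ∨ʷ vh = vh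
v0 ∨ʷ v0 = v0
v0 ∨ʷ v1 = v1
v1 ∨ʷ v0 = v1
v1 ∨ʷ v1 = v1

_∧ʷ_ : V3 → V3 → V3
vh ∧ʷ _  = vh
_  ∧ʷ vh = vh
v0 ∧ʷ v0 = v0
v0 ∧ʷ v1 = v0
v1 ∧ʷ v0 = v0
v1 ∧ʷ v1 = v1

¬ʷ : V3 → V3
¬ʷ v0 = v1
¬ʷ vh = vh
¬ʷ v1 = v0

J₀ʷ : V3 → V3
J₀ʷ v0 = v1
J₀ʷ vh = v0
J₀ʷ v1 = v0

J₁ʷ : V3 → V3
J₁ʷ v0 = v0
J₁ʷ vh = v1
J₁ʷ v1 = v0

J₂ʷ : V3 → V3
J₂ʷ v0 = v0
J₂ʷ vh = v0
J₂ʷ v1 = v1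

-- Homomorphisms from the formula algebra into WKᵉ are determined by
-- valuations of the variables.
eval : (ℕ → V3) → Fm → V3
eval v (var x)  = v x
eval v (φ ∨ᶠ ψ) = eval v φ ∨ʷ eval v ψ
eval v (φ ∧ᶠ ψ) = eval v φ ∧ʷ eval v ψ
eval v (¬ᶠ φ)   = ¬ʷ (eval v φ)
eval v (J₀ᶠ φ)  = J₀ʷ (eval v φ)
eval v (J₁ᶠ φ)  = J₁ʷ (eval v φ)
eval v (J₂ᶠ φ)  = J₂ʷ (eval v φ)
eval v 0ᶠ       = v0
eval v 1ᶠ       = v1

Logic : Set₂
Logic = (Fm → Set) → Fm → Set₁

Bᵉ : Logic
Bᵉ Γ φ = Lift (lsuc lzero)
  ((v : ℕ → V3) → (∀ γ → Γ γ → eval v γ ≡ v1) → eval v φ ≡ v1)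

Rule : Set
Rule = List Fm × Fm

-- The extension of a logic L by a list of rules: the least
-- (substitution-invariant) consequence relation containing L and all
-- substitution instances of the rules.
data Ext (L : Logic) (Rs : List Rule) (Γ : Fm → Set) : Fm → Set₁ where
  hyp   : ∀ {φ} → Γ φ → Ext L Rs Γ φ
  lstep : ∀ {φ} (Δ : Fm → Set) → (∀ δ → Δ δ → Ext L Rs Γ δ) →
          L Δ φ → Ext L Rs Γ φ
  rstep : ∀ (r : Rule) → r ∈ Rs → (σ : Subst) →
          All (λ γ → Ext L Rs Γ (sub σ γ)) (proj₁ r) →
          Ext L Rs Γ (sub σ (proj₂ r))

NBᵉ : Logic
NBᵉ = Ext Bᵉ ((J₁ᶠ (var 0) ∷ [] , var 1) ∷ [])

∅ : Fm → Set
∅ _ = ⊥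

Theorem : Logic → Fm → Set₁
Theorem L φ = L ∅ φ

Admissible : Logic → Rule → Set₁
Admissible L r = ∀ φ → Theorem (Ext L (r ∷ [])) φ → Theorem L φ

Derivable : Logic → Rule → Set₁
Derivable L (Γ , ψ) = L (λ φ → φ ∈ Γ) ψ

Passive : Rule → Set
Passive (Γ , ψ) = Σ ℕ (λ y → (ψ ≡ var y) × (¬ Any (Occurs y) Γ))

StructurallyComplete : Logic → Set₁
StructurallyComplete L = ∀ (r : Rule) → Admissible L r → Derivable L r

PassivelyStructurallyComplete : Logic → Set₁
PassivelyStructurallyComplete L =
  ∀ (r : Rule) → Passive r → Admissible L r → Derivable L r

{-# OPTIONS --safe #-}
-- Every theorem of NBᵉ is a WKᵉ-tautology: the new rule could only fire on
-- a tautology J₁ φ, but J₁ φ is 0 under every Boolean valuation.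
-- Hence J₁ x ⊢ y is admissible in Bᵉ, while x ↦ ½, y ↦ 0 refutes it.
--
-- For NBᵉ, let Γ ⊢ ψ be admissible.  If Γ has no Boolean model, every model
-- of Γ gives some variable of Γ the value ½, so Γ ⊢ J₁ (⋀ vars Γ) and the
-- rule J₁ x ⊢ y yields ψ.  If Γ has a Boolean model b, glue any model v of Γ
-- with b into a substitution σ in the single variable var 0, so that σ x
-- takes the value v x when var 0 is ½ and b x otherwise.  Then every σ γ
-- with γ ∈ Γ is a tautology, so σ ψ is a theorem of NBᵉ, hence a
-- tautology, and evaluating it where everything is ½ gives v ψ = 1.
module Submission where

open import Defs

open import Level using (lift)
open import Function using (_∘_)
open import Data.Bool using (Bool; true; false; not; _∨_; _∧_)
open import Data.Nat using (ℕ; _≟_)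
open import Data.List using (List; []; _∷_; _++_; concatMap)
open import Data.List.Membership.Propositional using (_∈_)
open import Data.List.Membership.Propositional.Properties using (∈-++⁺ˡ; ∈-++⁺ʳ; ∈-concatMap⁺)
open import Data.List.Relation.Unary.All as All using (All; []; _∷_)
open import Data.List.Relation.Unary.Any as Any using (here; there)
open import Data.Empty using (⊥-elim)
open import Data.Sum using (_⊎_; inj₁; inj₂)
open import Data.Product using (_×_; ∃; _,_)
open import Relation.Binary.Definitions using (DecidableEquality)
open import Relation.Binary.PropositionalEquality using (_≡_; _≢_; refl; sym; trans; cong; cong₂)
open import Relation.Nullary using (¬_; Dec; yes; no; contradiction)
open import Relation.Nullary.Decidable using (map′; _⊎-dec_)
open import Relation.Unary using (Decidable)

_≟ⱽ_ : DecidableEquality V3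
v0 ≟ⱽ v0 = yes refl
vh ≟ⱽ vh = yes refl
v1 ≟ⱽ v1 = yes refl
v0 ≟ⱽ vh = no λ ()
v0 ≟ⱽ v1 = no λ ()
vh ≟ⱽ v0 = no λ ()
vh ≟ⱽ v1 = no λ ()
v1 ≟ⱽ v0 = no λ ()
v1 ≟ⱽ vh = no λ ()

⌜_⌝ : Bool → V3
⌜ false ⌝ = v0
⌜ true ⌝  = v1

⌜_⌝ᶠ : Bool → Fm
⌜ false ⌝ᶠ = 0ᶠ
⌜ true ⌝ᶠ  = 1ᶠ

toBool : V3 → Bool
toBool v1 = true
toBool _  = false

⌜toBool⌝ : ∀ a → a ≢ vh → ⌜ toBool a ⌝ ≡ a
⌜toBool⌝ v0 _ = refl
⌜toBool⌝ vh a≢vh = contradiction refl a≢vh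
⌜toBool⌝ v1 _ = refl

half-or-bool : ∀ a → a ≡ vh ⊎ ∃ λ s → a ≡ ⌜ s ⌝
half-or-bool v0 = inj₂ (false , refl)
half-or-bool vh = inj₁ refl
half-or-bool v1 = inj₂ (true , refl)

∧ʷ-vhʳ : ∀ a → a ∧ʷ vh ≡ vh
∧ʷ-vhʳ v0 = refl
∧ʷ-vhʳ vh = refl
∧ʷ-vhʳ v1 = refl

eval-cong-occurs : ∀ {v v'} φ → (∀ {x} → Occurs x φ → v x ≡ v' x) → eval v φ ≡ eval v' φ
eval-cong-occurs (var x)  eq = eq here
eval-cong-occurs (φ ∨ᶠ ψ) eq = cong₂ _∨ʷ_ (eval-cong-occurs φ (eq ∘ ∨l)) (eval-cong-occurs ψ (eq ∘ ∨r))
eval-cong-occurs (φ ∧ᶠ ψ) eq = cong₂ _∧ʷ_ (eval-cong-occurs φ (eq ∘ ∧l)) (eval-cong-occurs ψ (eq ∘ ∧r))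
eval-cong-occurs (¬ᶠ φ)   eq = cong ¬ʷ  (eval-cong-occurs φ (eq ∘ ¬o))
eval-cong-occurs (J₀ᶠ φ)  eq = cong J₀ʷ (eval-cong-occurs φ (eq ∘ J₀o))
eval-cong-occurs (J₁ᶠ φ)  eq = cong J₁ʷ (eval-cong-occurs φ (eq ∘ J₁o))
eval-cong-occurs (J₂ᶠ φ)  eq = cong J₂ʷ (eval-cong-occurs φ (eq ∘ J₂o))
eval-cong-occurs 0ᶠ       _  = refl
eval-cong-occurs 1ᶠ       _  = refl

eval-cong : ∀ {v v'} φ → (∀ x → v x ≡ v' x) → eval v φ ≡ eval v' φ
eval-cong φ eq = eval-cong-occurs φ (λ {x} _ → eq x)

eval-sub : ∀ w σ φ → eval w (sub σ φ) ≡ eval (eval w ∘ σ) φ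
eval-sub w σ (var x)  = refl
eval-sub w σ (φ ∨ᶠ ψ) = cong₂ _∨ʷ_ (eval-sub w σ φ) (eval-sub w σ ψ)
eval-sub w σ (φ ∧ᶠ ψ) = cong₂ _∧ʷ_ (eval-sub w σ φ) (eval-sub w σ ψ)
eval-sub w σ (¬ᶠ φ)   = cong ¬ʷ  (eval-sub w σ φ)
eval-sub w σ (J₀ᶠ φ)  = cong J₀ʷ (eval-sub w σ φ)
eval-sub w σ (J₁ᶠ φ)  = cong J₁ʷ (eval-sub w σ φ)
eval-sub w σ (J₂ᶠ φ)  = cong J₂ʷ (eval-sub w σ φ)
eval-sub w σ 0ᶠ       = refl
eval-sub w σ 1ᶠ       = refl

evalᴮ : (ℕ → Bool) → Fm → Bool
evalᴮ b (var x)  = b x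
evalᴮ b (φ ∨ᶠ ψ) = evalᴮ b φ ∨ evalᴮ b ψ
evalᴮ b (φ ∧ᶠ ψ) = evalᴮ b φ ∧ evalᴮ b ψ
evalᴮ b (¬ᶠ φ)   = not (evalᴮ b φ)
evalᴮ b (J₀ᶠ φ)  = not (evalᴮ b φ)
evalᴮ b (J₁ᶠ φ)  = false
evalᴮ b (J₂ᶠ φ)  = evalᴮ b φ
evalᴮ b 0ᶠ       = false
evalᴮ b 1ᶠ       = true

⌜⌝-∨ : ∀ s t → ⌜ s ⌝ ∨ʷ ⌜ t ⌝ ≡ ⌜ s ∨ t ⌝
⌜⌝-∨ false false = refl
⌜⌝-∨ false true  = refl
⌜⌝-∨ true  false = refl
⌜⌝-∨ true  true  = refl

⌜⌝-∧ : ∀ s t → ⌜ s ⌝ ∧ʷ ⌜ t ⌝ ≡ ⌜ s ∧ t ⌝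
⌜⌝-∧ false false = refl
⌜⌝-∧ false true  = refl
⌜⌝-∧ true  false = refl
⌜⌝-∧ true  true  = refl

⌜⌝-¬ : ∀ s → ¬ʷ ⌜ s ⌝ ≡ ⌜ not s ⌝
⌜⌝-¬ false = refl
⌜⌝-¬ true  = refl

⌜⌝-J₀ : ∀ s → J₀ʷ ⌜ s ⌝ ≡ ⌜ not s ⌝
⌜⌝-J₀ false = refl
⌜⌝-J₀ true  = refl

⌜⌝-J₁ : ∀ s → J₁ʷ ⌜ s ⌝ ≡ v0
⌜⌝-J₁ false = refl
⌜⌝-J₁ true  = refl

⌜⌝-J₂ : ∀ s → J₂ʷ ⌜ s ⌝ ≡ ⌜ s ⌝
⌜⌝-J₂ false = refl
⌜⌝-J₂ true  = refl

eval-⌜⌝ : ∀ b φ → eval (⌜_⌝ ∘ b) φ ≡ ⌜ evalᴮ b φ ⌝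
eval-⌜⌝ b (var x) = refl
eval-⌜⌝ b (φ ∨ᶠ ψ) rewrite eval-⌜⌝ b φ | eval-⌜⌝ b ψ = ⌜⌝-∨ (evalᴮ b φ) (evalᴮ b ψ)
eval-⌜⌝ b (φ ∧ᶠ ψ) rewrite eval-⌜⌝ b φ | eval-⌜⌝ b ψ = ⌜⌝-∧ (evalᴮ b φ) (evalᴮ b ψ)
eval-⌜⌝ b (¬ᶠ φ)   rewrite eval-⌜⌝ b φ = ⌜⌝-¬  (evalᴮ b φ)
eval-⌜⌝ b (J₀ᶠ φ)  rewrite eval-⌜⌝ b φ = ⌜⌝-J₀ (evalᴮ b φ)
eval-⌜⌝ b (J₁ᶠ φ)  rewrite eval-⌜⌝ b φ = ⌜⌝-J₁ (evalᴮ b φ)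
eval-⌜⌝ b (J₂ᶠ φ)  rewrite eval-⌜⌝ b φ = ⌜⌝-J₂ (evalᴮ b φ)
eval-⌜⌝ b 0ᶠ = refl
eval-⌜⌝ b 1ᶠ = refl

Tautology : Fm → Set
Tautology φ = ∀ v → eval v φ ≡ v1

J₁-not-tautology : ∀ φ → ¬ Tautology (J₁ᶠ φ)
J₁-not-tautology φ taut with () ← trans (sym (eval-⌜⌝ (λ _ → false) (J₁ᶠ φ))) (taut _)

tautology⇒Bᵉ : ∀ {Γ} φ → Tautology φ → Bᵉ Γ φ
tautology⇒Bᵉ _ taut = lift λ v _ → taut v

tautology⇒Ext : ∀ {L Rs Γ} → (∀ χ → Tautology χ → L ∅ χ) → ∀ φ → Tautology φ → Ext L Rs Γ φ
tautology⇒Ext taut⇒L φ taut = lstep ∅ (λ _ ()) (taut⇒L φ taut)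

base⇒Ext : ∀ {L Rs Γ φ} → L Γ φ → Ext L Rs Γ φ
base⇒Ext = lstep _ (λ _ → hyp)

J₁-rule : Rule
J₁-rule = J₁ᶠ (var 0) ∷ [] , var 1

NBᵉ-sound : ∀ {φ} → Theorem NBᵉ φ → Tautology φ
NBᵉ-sound (hyp ())
NBᵉ-sound (lstep Δ ds (lift f)) v = f v (λ δ d → NBᵉ-sound (ds δ d) v)
NBᵉ-sound (rstep _ (here refl) σ (p ∷ [])) = ⊥-elim (J₁-not-tautology (σ 0) (NBᵉ-sound p))

J₁-explosion : ∀ {Γ ψ} φ → NBᵉ Γ (J₁ᶠ φ) → NBᵉ Γ ψ
J₁-explosion {ψ = ψ} φ p = rstep J₁-rule (here refl) (λ { 0 → φ ; _ → ψ }) (p ∷ [])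

J₁-rule-passive : Passive J₁-rule
J₁-rule-passive = 1 , refl , λ { (here (J₁o ())) ; (there ()) }

J₁-rule-admissible : Admissible Bᵉ J₁-rule
J₁-rule-admissible φ = tautology⇒Bᵉ φ ∘ NBᵉ-sound

J₁-rule-underivable : ¬ Derivable Bᵉ J₁-rule
J₁-rule-underivable (lift f) with () ← f (λ { 0 → vh ; _ → v0 }) (λ { _ (here refl) → refl })

Bᵉ-not-passively-structurally-complete : ¬ PassivelyStructurallyComplete Bᵉ
Bᵉ-not-passively-structurally-complete psc =
  J₁-rule-underivable (psc J₁-rule J₁-rule-passive J₁-rule-admissible)

vars : Fm → List ℕ
vars (var x)  = x ∷ []
vars (φ ∨ᶠ ψ) = vars φ ++ vars ψ
vars (φ ∧ᶠ ψ) = vars φ ++ vars ψ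
vars (¬ᶠ φ)   = vars φ
vars (J₀ᶠ φ)  = vars φ
vars (J₁ᶠ φ)  = vars φ
vars (J₂ᶠ φ)  = vars φ
vars 0ᶠ       = []
vars 1ᶠ       = []

occurs⇒∈vars : ∀ {x φ} → Occurs x φ → x ∈ vars φ
occurs⇒∈vars here       = here refl
occurs⇒∈vars (∨l o)     = ∈-++⁺ˡ (occurs⇒∈vars o)
occurs⇒∈vars (∨r {φ} o) = ∈-++⁺ʳ (vars φ) (occurs⇒∈vars o)
occurs⇒∈vars (∧l o)     = ∈-++⁺ˡ (occurs⇒∈vars o)
occurs⇒∈vars (∧r {φ} o) = ∈-++⁺ʳ (vars φ) (occurs⇒∈vars o)
occurs⇒∈vars (¬o o)     = occurs⇒∈vars o
occurs⇒∈vars (J₀o o)    = occurs⇒∈vars o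
occurs⇒∈vars (J₁o o)    = occurs⇒∈vars o
occurs⇒∈vars (J₂o o)    = occurs⇒∈vars o

varsᴸ : List Fm → List ℕ
varsᴸ = concatMap vars

occurs⇒∈varsᴸ : ∀ {x γ Γ} → γ ∈ Γ → Occurs x γ → x ∈ varsᴸ Γ
occurs⇒∈varsᴸ γ∈Γ o = ∈-concatMap⁺ vars (Any.map (λ { refl → occurs⇒∈vars o }) γ∈Γ)

_≈[_]_ : {A : Set} → (ℕ → A) → List ℕ → (ℕ → A) → Set
f ≈[ xs ] g = ∀ {x} → x ∈ xs → f x ≡ g x

Satisfies : (ℕ → V3) → List Fm → Set
Satisfies v Γ = All (λ γ → eval v γ ≡ v1) Γ

satisfies? : ∀ v Γ → Dec (Satisfies v Γ)
satisfies? v = All.all? (λ γ → eval v γ ≟ⱽ v1)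

satisfies-cong : ∀ {v v'} Γ → v ≈[ varsᴸ Γ ] v' → Satisfies v Γ → Satisfies v' Γ
satisfies-cong Γ v≈v' sat = All.tabulate λ {γ} γ∈Γ →
  trans (eval-cong-occurs γ (λ o → sym (v≈v' (occurs⇒∈varsᴸ γ∈Γ o)))) (All.lookup sat γ∈Γ)

_[_↦_] : (ℕ → Bool) → ℕ → Bool → ℕ → Bool
(b [ x ↦ t ]) y with y ≟ x
... | yes _ = t
... | no _  = b y

↦-self : ∀ b x y → (b [ x ↦ b x ]) y ≡ b y
↦-self b x y with y ≟ x
... | yes refl = refl
... | no _     = refl

↦-cong : ∀ {b b' xs x t} → b ≈[ xs ] b' → (b [ x ↦ t ]) ≈[ x ∷ xs ] (b' [ x ↦ t ])
↦-cong {x = x} b≈b' {y} y∈ with y ≟ x | y∈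
... | yes _  | _          = refl
... | no y≢x | here y≡x   = contradiction y≡x y≢x
... | no _   | there y∈xs = b≈b' y∈xs

DependsOn : List ℕ → ((ℕ → Bool) → Set) → Set
DependsOn xs P = ∀ {b b'} → b ≈[ xs ] b' → P b → P b'

any-valuation? : ∀ xs {P} → Decidable P → DependsOn xs P → Dec (∃ P)
any-valuation? [] P? dep with P? (λ _ → false)
... | yes p = yes (_ , p)
... | no ¬p = no λ (_ , p) → ¬p (dep (λ ()) p)
any-valuation? (x ∷ xs) {P} P? dep = map′ from to (fixed? false ⊎-dec fixed? true)
  where
  Fixed : Bool → Set
  Fixed t = ∃ λ b → P (b [ x ↦ t ])
  fixed? : ∀ t → Dec (Fixed t)
  fixed? t = any-valuation? xs (P? ∘ _[ x ↦ t ]) (dep ∘ ↦-cong)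
  from : Fixed false ⊎ Fixed true → ∃ P
  from (inj₁ (_ , p)) = _ , p
  from (inj₂ (_ , p)) = _ , p
  fixed : ∀ {b} t → P (b [ x ↦ t ]) → Fixed false ⊎ Fixed true
  fixed false p = inj₁ (_ , p)
  fixed true  p = inj₂ (_ , p)
  to : ∃ P → Fixed false ⊎ Fixed true
  to (b , p) = fixed (b x) (dep (λ {y} _ → sym (↦-self b x y)) p)

BoolModel : List Fm → Set
BoolModel Γ = ∃ λ b → Satisfies (⌜_⌝ ∘ b) Γ

bool-model? : ∀ Γ → Dec (BoolModel Γ)
bool-model? Γ = any-valuation? (varsᴸ Γ) (λ b → satisfies? _ Γ) (λ b≈b' → satisfies-cong Γ (cong ⌜_⌝ ∘ b≈b'))

⋀ : List ℕ → Fm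
⋀ []       = 1ᶠ
⋀ (x ∷ xs) = var x ∧ᶠ ⋀ xs

⋀-defined : ∀ v xs → eval v (⋀ xs) ≢ vh → ∀ {x} → x ∈ xs → v x ≢ vh
⋀-defined v (x ∷ xs) defined (here refl) vx≡vh = defined (cong (_∧ʷ eval v (⋀ xs)) vx≡vh)
⋀-defined v (x ∷ xs) defined (there y∈xs) =
  ⋀-defined v xs (λ rest≡vh → defined (trans (cong (v x ∧ʷ_) rest≡vh) (∧ʷ-vhʳ (v x)))) y∈xs

no-bool-model⇒J₁⋀ : ∀ Γ → ¬ BoolModel Γ → Bᵉ (_∈ Γ) (J₁ᶠ (⋀ (varsᴸ Γ)))
no-bool-model⇒J₁⋀ Γ ¬model = lift λ v sat → J₁-true v (All.tabulate λ {γ} → sat γ)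
  where
  J₁-true : ∀ v → Satisfies v Γ → eval v (J₁ᶠ (⋀ (varsᴸ Γ))) ≡ v1
  J₁-true v sat with eval v (⋀ (varsᴸ Γ)) ≟ⱽ vh
  ... | yes half   = cong J₁ʷ half
  ... | no defined = contradiction (toBool ∘ v , satisfies-cong Γ ⌜toBool∘v⌝≈v sat) ¬model
    where
    ⌜toBool∘v⌝≈v : v ≈[ varsᴸ Γ ] (⌜_⌝ ∘ toBool ∘ v)
    ⌜toBool∘v⌝≈v {x} x∈ = sym (⌜toBool⌝ (v x) (⋀-defined v _ defined x∈))

switch : V3 → Bool → Fm
switch vh t = (var 0 ∨ᶠ (¬ᶠ var 0)) ∧ᶠ ⌜ t ⌝ᶠ
switch v0 t = J₀ᶠ (J₁ᶠ (var 0)) ∧ᶠ ⌜ t ⌝ᶠ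
switch v1 t = J₁ᶠ (var 0) ∨ᶠ ⌜ t ⌝ᶠ

eval-switch-half : ∀ {w} → w 0 ≡ vh → ∀ a t → eval w (switch a t) ≡ a
eval-switch-half eq vh t     rewrite eq = refl
eval-switch-half eq v0 false rewrite eq = refl
eval-switch-half eq v0 true  rewrite eq = refl
eval-switch-half eq v1 false rewrite eq = refl
eval-switch-half eq v1 true  rewrite eq = refl

eval-switch-bool : ∀ {w} s → w 0 ≡ ⌜ s ⌝ → ∀ a t → eval w (switch a t) ≡ ⌜ t ⌝
eval-switch-bool false eq vh false rewrite eq = refl
eval-switch-bool false eq vh true  rewrite eq = refl
eval-switch-bool true  eq vh false rewrite eq = refl
eval-switch-bool true  eq vh true  rewrite eq = refl
eval-switch-bool false eq v0 false rewrite eq = refl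
eval-switch-bool false eq v0 true  rewrite eq = refl
eval-switch-bool true  eq v0 false rewrite eq = refl
eval-switch-bool true  eq v0 true  rewrite eq = refl
eval-switch-bool false eq v1 false rewrite eq = refl
eval-switch-bool false eq v1 true  rewrite eq = refl
eval-switch-bool true  eq v1 false rewrite eq = refl
eval-switch-bool true  eq v1 true  rewrite eq = refl

switchSubst : (ℕ → V3) → (ℕ → Bool) → Subst
switchSubst v b x = switch (v x) (b x)

eval-switchSubst-half : ∀ {w} v b φ → w 0 ≡ vh → eval w (sub (switchSubst v b) φ) ≡ eval v φ
eval-switchSubst-half {w} v b φ eq =
  trans (eval-sub w _ φ) (eval-cong φ (λ x → eval-switch-half eq (v x) (b x)))

eval-switchSubst-bool : ∀ {w s} v b φ → w 0 ≡ ⌜ s ⌝ → eval w (sub (switchSubst v b) φ) ≡ eval (⌜_⌝ ∘ b) φ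
eval-switchSubst-bool {w} {s} v b φ eq =
  trans (eval-sub w _ φ) (eval-cong φ (λ x → eval-switch-bool s eq (v x) (b x)))

bool-model⇒Bᵉ : ∀ {Γ ψ} → BoolModel Γ → Admissible NBᵉ (Γ , ψ) → Bᵉ (_∈ Γ) ψ
bool-model⇒Bᵉ {Γ} {ψ} (b , sat-b) adm = lift λ v sat-v →
  trans (sym (eval-switchSubst-half v b ψ refl)) (NBᵉ-sound (switched-conclusion v sat-v) (λ _ → vh))
  where
  switched-premise : ∀ {v γ} → (∀ γ → γ ∈ Γ → eval v γ ≡ v1) → γ ∈ Γ → Tautology (sub (switchSubst v b) γ)
  switched-premise {v} {γ} sat-v γ∈Γ w with half-or-bool (w 0)
  ... | inj₁ half     = trans (eval-switchSubst-half v b γ half) (sat-v γ γ∈Γ)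
  ... | inj₂ (_ , eq) = trans (eval-switchSubst-bool v b γ eq) (All.lookup sat-b γ∈Γ)
  switched-conclusion : ∀ v → (∀ γ → γ ∈ Γ → eval v γ ≡ v1) → Theorem NBᵉ (sub (switchSubst v b) ψ)
  switched-conclusion v sat-v = adm _ (rstep (Γ , ψ) (here refl) (switchSubst v b)
    (All.tabulate λ {γ} → tautology⇒Ext (tautology⇒Ext tautology⇒Bᵉ) _ ∘ switched-premise sat-v))

NBᵉ-structurally-complete : StructurallyComplete NBᵉ
NBᵉ-structurally-complete (Γ , ψ) adm with bool-model? Γ
... | yes model = base⇒Ext (bool-model⇒Bᵉ model adm)
... | no ¬model = J₁-explosion (⋀ (varsᴸ Γ)) (base⇒Ext (no-bool-model⇒J₁⋀ Γ ¬model))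

corollary3p13 : (¬ PassivelyStructurallyComplete Bᵉ) × StructurallyComplete NBᵉ
corollary3p13 = Bᵉ-not-passively-structurally-complete , NBᵉ-structurally-complete
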